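{- Let $f$ be a comparator network of order $n$ that is a selection network for parameter $k$ ($1\le k\le n$), with input variables $x_1,\dots,x_n$ and output variables $y_1,\dots,y_n$, and let $\phi(f)$ be its half encoding. Suppose exactly $k-1$ of the input variables are set to true, all other variables are undefined, and unit propagation has been performed on $\phi(f)$ (so that $y_1,\dots,y_{k-1}$ are true). If we then set $y_k$ to false, unit propagation sets all the input variables that were undefined to false.
   Context: A comparator $c_{i,j}$ ($i<j$) on $\mathbb N^n$ puts the maximum of the entries at positions $i,j$ into position $i$ and the minimum into position $j$; a comparator network of order $n$ is a finite sequence of comparators applied in order. A sequence $\bar x\in\mathbb N^n$ is top $k$ sorted if $x_1\ge\dots\ge x_k$ and $x_i\ge x_j$ for all $i\le k<j$; a comparator network $f$ of order $n$ is a selection network for $k$ if $f(\bar x)$ is top $k$ sorted for every $\bar x\in\mathbb N^n$. Half encoding: each wire position initially carries the boolean input variable $x_i$; processing the comparators in order, a comparator $c_{i,j}$ whose current variables at positions $i,j$ are $a,b$ introduces fresh variables $c,d$, which become the current variables of positions $i$ and $j$ respectively, together with the clauses $hcomp(a,b,c,d)=(\neg a\vee c)\wedge(\neg b\vee c)\wedge(\neg a\vee\neg b\vee d)$. The output variables $y_1,\dots,y_n$ are the final current variables of positions $1,\dots,n$, and $\phi(f)$ is the conjunction of all these clauses. Each variable is true (1), false (0) or undefined. Unit propagation repeatedly finds a clause in which all literals but one are false and the remaining literal is undefined, and sets that literal to true, until a fixpoint is reached. -}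

module Defs where

open import Data.Nat as ℕ using (ℕ; zero; suc; _≤_; _<_; _⊔_; _⊓_; _≡ᵇ_; _<?_)
open import Data.Fin as Fin using (Fin; toℕ; fromℕ<)
open import Data.Fin.Subset using (Subset)
open import Data.Bool using (Bool; true; false; if_then_else_; not)
open import Data.Maybe using (Maybe; just; nothing)
open import Data.Product using (_×_; _,_; proj₁; proj₂; Σ; ∃)
open import Data.List using (List; []; _∷_; _++_)
open import Data.List.Relation.Unary.All using (All)
open import Data.List.Membership.Propositional using (_∈_)
open import Data.Vec using (lookup)
open import Relation.Binary.PropositionalEquality using (_≡_)
open import Relation.Nullary using (¬_; yes; no; does)
open import Relation.Binary.Construct.Closure.ReflexiveTransitive using (Star)

-- Comparator networks on ℕⁿ (wires are Fin n, position i ↦ Fin index i-1)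

record Comparator (n : ℕ) : Set where
  constructor comp
  field
    i   : Fin n
    j   : Fin n
    i<j : i Fin.< j

Network : ℕ → Set
Network n = List (Comparator n)

applyComp : ∀ {n} → Comparator n → (Fin n → ℕ) → (Fin n → ℕ)
applyComp (comp i j _) x t =
  if does (t Fin.≟ i) then x i ⊔ x j
  else if does (t Fin.≟ j) then x i ⊓ x j
  else x t

applyNet : ∀ {n} → Network n → (Fin n → ℕ) → (Fin n → ℕ)
applyNet []       x = x
applyNet (c ∷ cs) x = applyNet cs (applyComp c x)

-- top k sorted (1-indexed positions p correspond to Fin indices p-1)
TopSorted : ∀ {n} → ℕ → (Fin n → ℕ) → Set
TopSorted {n} k x =
  (∀ (a b : Fin n) → suc (toℕ a) ≡ toℕ b → toℕ b < k → x b ≤ x a)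
  × (∀ (a b : Fin n) → toℕ a < k → k ≤ toℕ b → x b ≤ x a)

SelectionNetwork : ∀ {n} → ℕ → Network n → Set
SelectionNetwork {n} k f = ∀ (x : Fin n → ℕ) → TopSorted k (applyNet f x)

Var : Set
Var = ℕ

-- (true , v) is the literal v, (false , v) is ¬v
Literal : Set
Literal = Bool × Var

Clause : Set
Clause = List Literal

CNF : Set
CNF = List Clause

hcomp : Var → Var → Var → Var → CNF
hcomp a b c d =
  ((false , a) ∷ (true , c) ∷ [])
  ∷ ((false , b) ∷ (true , c) ∷ [])
  ∷ ((false , a) ∷ (false , b) ∷ (true , d) ∷ [])
  ∷ []

record EncState (n : ℕ) : Set where
  constructor st
  field
    cur     : Fin n → Var
    fresh   : Var
    clauses : CNF

encComp : ∀ {n} → Comparator n → EncState n → EncState n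
encComp (comp i j _) (st cur fr cls) =
  st (λ t → if does (t Fin.≟ i) then fr
            else if does (t Fin.≟ j) then suc fr
            else cur t)
     (suc (suc fr))
     (cls ++ hcomp (cur i) (cur j) fr (suc fr))

encNet : ∀ {n} → Network n → EncState n → EncState n
encNet []       s = s
encNet (c ∷ cs) s = encNet cs (encComp c s)

-- input variable x_i is the variable toℕ i (i.e. variables 0 … n-1);
-- fresh variables start at n
initState : (n : ℕ) → EncState n
initState n = st toℕ n []

phi : ∀ {n} → Network n → CNF
phi {n} f = EncState.clauses (encNet f (initState n))

outVar : ∀ {n} → Network n → Fin n → Var
outVar {n} f p = EncState.cur (encNet f (initState n)) p

inVar : ∀ {n} → Fin n → Var
inVar = toℕ

-- nothing = undefined
Assignment : Set
Assignment = Var → Maybe Bool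

litVal : Assignment → Literal → Maybe Bool
litVal α (true  , v) = α v
litVal α (false , v) with α v
... | just b  = just (not b)
... | nothing = nothing

IsFalse : Assignment → Literal → Set
IsFalse α l = litVal α l ≡ just false

set : Assignment → Var → Bool → Assignment
set α v b w = if w ≡ᵇ v then just b else α w

setLit : Assignment → Literal → Assignment
setLit α (b , v) = set α v b

data UPStep (φ : CNF) (α : Assignment) : Assignment → Set where
  unit : ∀ (L R : List Literal) (l : Literal) →
         (L ++ l ∷ R) ∈ φ →
         All (IsFalse α) L → All (IsFalse α) R →
         litVal α l ≡ nothing →
         UPStep φ α (setLit α l)

UnitPropagates : CNF → Assignment → Assignment → Set
UnitPropagates φ α β = Star (UPStep φ) α β × (∀ γ → ¬ UPStep φ β γ)

initAssign : ∀ {n} → Subset n → Assignment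
initAssign {n} T v with v <? n
... | yes v<n = if lookup T (fromℕ< v<n) then just true else nothing
... | no  _   = nothing

-- Let N and N′ be the valuations of the variables of φ(f) computed by the network on the input
-- sets T and T ∪ {i}; both are models of φ(f). Unit propagation from an assignment agreeing with N
-- keeps agreeing with N, and a fixpoint containing the true inputs sets every variable that N
-- makes true. Comparators permute their input and are monotone, so at every stage of the network
-- N′ exceeds N on exactly one wire; since f selects, at the outputs that wire is y_k, false under N
-- (k − 1 ones) and true under N′ (k ones). Going backwards through the network, the comparator
-- clause ¬a ∨ c (if the other input b is false) or ¬a ∨ ¬b ∨ d (if b is true) lets unit propagation
-- pass the value false from the differing output to the differing input, down to the input x_i.

module Submission where

open import Defs
open import Data.Nat as ℕ using (ℕ; zero; suc; _≤_; _<_; _⊔_; _⊓_; _+_; _∸_; _≡ᵇ_; _<?_; z≤n; s≤s)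
open import Data.Nat.Properties as ℕ
  using (≤-refl; ≤-reflexive; ≤-trans; <-trans; <-irrefl; <⇒≤; <⇒≢; ≰⇒>; ≤∧≢⇒<; n≤0⇒n≡0;
         n<1+n; m<n⇒m<1+n; +-suc; m∸n+n≡m; +-mono-≤; +-mono-<-≤; +-mono-≤-<;
         ⊔-mono-≤; ⊓-mono-≤; m≥n⇒m⊔n≡m; m≥n⇒m⊓n≡n; m≤n⇒m⊔n≡n; m≤n⇒m⊓n≡m; +-0-commutativeMonoid)
open import Data.Fin as Fin using (Fin; toℕ; fromℕ<) renaming (zero to fzero; suc to fsuc)
open import Data.Fin.Properties
  using (punchInᵢ≢i; toℕ-injective; toℕ-fromℕ<; fromℕ<-toℕ; toℕ<n) renaming (<⇒≢ to <⇒≢ᶠ)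
open import Data.Vec.Functional using (removeAt)
open import Data.Vec using ([]; _∷_; lookup; _[_]≔_)
open import Data.Vec.Properties using (lookup∘updateAt; lookup∘updateAt′; lookup⇒[]=)
open import Data.Fin.Subset using (Subset; ∣_∣; _∉_)
open import Data.Fin.Permutation using (transpose)
import Data.Fin.Permutation.Components as PC
open import Data.Bool using (Bool; true; false; not; if_then_else_; _∨_; _∧_)
open import Data.Maybe using (just; nothing; fromMaybe)
open import Data.Maybe.Properties using (just-injective)
open import Data.Bool.Properties using (∨-zeroʳ)
open import Data.List using ([]; _∷_; _++_)
open import Data.List.Membership.Propositional using (_∈_)
open import Data.List.Membership.Propositional.Properties using (∈-++⁺ˡ; ∈-++⁺ʳ; ∈-++⁻)
open import Data.List.Relation.Unary.Any using (Any; here; there)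
import Data.List.Relation.Unary.Any.Properties as Any
open import Data.List.Relation.Unary.All as All using (All; []; _∷_)
open import Data.List.Relation.Unary.All.Properties using (All¬⇒¬Any)
open import Relation.Binary.Construct.Closure.ReflexiveTransitive using (Star; ε; _◅_)
open import Data.Sum using (_⊎_; inj₁; inj₂)
open import Data.Product using (_×_; _,_; proj₁; proj₂)
open import Data.Empty using (⊥)
open import Function using (_∘_)
open import Relation.Binary.PropositionalEquality
open import Relation.Nullary using (¬_; yes; no; does; contradiction)
open import Relation.Nullary.Decidable using (dec-true; dec-false)
open import Algebra.Properties.CommutativeMonoid.Sum +-0-commutativeMonoid
  using (sum; sum-cong-≗; sum-permute; sum-remove)

private
  variable
    n : ℕ

-- Sums of vectors of naturals

Pointwise≤ : (Fin n → ℕ) → (Fin n → ℕ) → Set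
Pointwise≤ u v = ∀ t → u t ≤ v t

sum-mono-≤ : ∀ {u v : Fin n → ℕ} → Pointwise≤ u v → sum u ≤ sum v
sum-mono-≤ {zero}  u≤v = z≤n
sum-mono-≤ {suc n} u≤v = +-mono-≤ (u≤v fzero) (sum-mono-≤ (u≤v ∘ fsuc))

sum-mono-< : ∀ {u v : Fin n → ℕ} → Pointwise≤ u v → ∀ {t} → u t < v t → sum u < sum v
sum-mono-< u≤v {fzero}  ut<vt = +-mono-<-≤ ut<vt (sum-mono-≤ (u≤v ∘ fsuc))
sum-mono-< u≤v {fsuc t} ut<vt = +-mono-≤-< (u≤v fzero) (sum-mono-< (u≤v ∘ fsuc) ut<vt)

sum-mono-<₂ : ∀ {u v : Fin n → ℕ} → Pointwise≤ u v → ∀ {t t′} → t ≢ t′ →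
  u t < v t → u t′ < v t′ → suc (sum u) < sum v
sum-mono-<₂ u≤v {fzero}  {fzero}   t≢t′ _ _ = contradiction refl t≢t′
sum-mono-<₂ {u = u} {v} u≤v {fzero}  {fsuc _} _ u₀<v₀ ut′<vt′ =
  subst (_≤ sum v) (cong suc (+-suc (u fzero) _)) (+-mono-≤ u₀<v₀ (sum-mono-< (u≤v ∘ fsuc) ut′<vt′))
sum-mono-<₂ {u = u} {v} u≤v {fsuc _} {fzero}  _ ut<vt u₀<v₀ =
  subst (_≤ sum v) (cong suc (+-suc (u fzero) _)) (+-mono-≤ u₀<v₀ (sum-mono-< (u≤v ∘ fsuc) ut<vt))
sum-mono-<₂ {u = u} {v} u≤v {fsuc _} {fsuc _} t≢t′ ut<vt ut′<vt′ =
  subst (_≤ sum v) (cong suc (+-suc (u fzero) _))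
    (+-mono-≤-< (u≤v fzero) (sum-mono-<₂ (u≤v ∘ fsuc) (t≢t′ ∘ cong fsuc) ut<vt ut′<vt′))

sum-increment : ∀ {u v : Fin n → ℕ} i → v i ≡ suc (u i) → (∀ t → t ≢ i → v t ≡ u t) →
  sum v ≡ suc (sum u)
sum-increment {suc n} {u} {v} i vi≡1+ui v≗u = begin
  sum v                            ≡⟨ sum-remove v ⟩
  v i + sum (removeAt v i)         ≡⟨ cong₂ _+_ vi≡1+ui (sum-cong-≗ (λ t → v≗u _ (punchInᵢ≢i i t))) ⟩
  suc (u i + sum (removeAt u i))   ≡⟨ cong suc (sym (sum-remove u)) ⟩
  suc (sum u)                      ∎
  where open ≡-Reasoning

sum-≥-prefix : ∀ (u : Fin n → ℕ) m → m ≤ n → (∀ a → toℕ a < m → 1 ≤ u a) → m ≤ sum u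
sum-≥-prefix         u zero    _         _   = z≤n
sum-≥-prefix {suc n} u (suc m) (s≤s m≤n) pos =
  +-mono-≤ (pos fzero (s≤s z≤n)) (sum-≥-prefix (u ∘ fsuc) m m≤n (λ a a<m → pos (fsuc a) (s≤s a<m)))

sum-≤-prefix : ∀ (u : Fin n → ℕ) m →
  (∀ a → toℕ a < m → u a ≤ 1) → (∀ a → m ≤ toℕ a → u a ≡ 0) → sum u ≤ m
sum-≤-prefix {zero}  u m       _   _    = z≤n
sum-≤-prefix {suc n} u zero    _   null rewrite null fzero z≤n =
  sum-≤-prefix (u ∘ fsuc) zero (λ _ ()) (λ a _ → null (fsuc a) z≤n)
sum-≤-prefix {suc n} u (suc m) ≤1 null =
  +-mono-≤ (≤1 fzero (s≤s z≤n))
    (sum-≤-prefix (u ∘ fsuc) m (λ a a<m → ≤1 (fsuc a) (s≤s a<m)) (λ a m≤a → null (fsuc a) (s≤s m≤a)))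

-- Comparators permute their input monotonically

applyComp-permutes : ∀ (c : Comparator n) x →
  applyComp c x ≗ x ⊎ applyComp c x ≗ x ∘ PC.transpose (Comparator.i c) (Comparator.j c)
applyComp-permutes (comp i j i<j) x with x j ℕ.≤? x i
... | yes xj≤xi = inj₁ sorted
  where
  sorted : applyComp (comp i j i<j) x ≗ x
  sorted t with t Fin.≟ i
  ... | yes refl = m≥n⇒m⊔n≡m xj≤xi
  ... | no _ with t Fin.≟ j
  ...   | yes refl = m≥n⇒m⊓n≡n xj≤xi
  ...   | no _ = refl
... | no xj≰xi = inj₂ swapped
  where
  xi≤xj = <⇒≤ (≰⇒> xj≰xi)
  swapped : applyComp (comp i j i<j) x ≗ x ∘ PC.transpose i j
  swapped t with t Fin.≟ i
  ... | yes refl = m≤n⇒m⊔n≡n xi≤xj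
  ... | no _ with t Fin.≟ j
  ...   | yes refl = m≤n⇒m⊓n≡m xi≤xj
  ...   | no _ = refl

sum-applyComp : ∀ (c : Comparator n) x → sum (applyComp c x) ≡ sum x
sum-applyComp c@(comp i j _) x with applyComp-permutes c x
... | inj₁ c·x≗x = sum-cong-≗ c·x≗x
... | inj₂ c·x≗x∘τ = trans (sum-cong-≗ c·x≗x∘τ) (sym (sum-permute x (transpose i j)))

applyComp-cong : ∀ (c : Comparator n) {x y} → x ≗ y → applyComp c x ≗ applyComp c y
applyComp-cong (comp i j _) x≗y t rewrite x≗y i | x≗y j | x≗y t = refl

applyComp-mono : ∀ (c : Comparator n) {x y} → Pointwise≤ x y → Pointwise≤ (applyComp c x) (applyComp c y)
applyComp-mono (comp i j _) x≤y t with does (t Fin.≟ i) | does (t Fin.≟ j)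
... | true  | _     = ⊔-mono-≤ (x≤y i) (x≤y j)
... | false | true  = ⊓-mono-≤ (x≤y i) (x≤y j)
... | false | false = x≤y t

applyNet-cong : ∀ (f : Network n) {x y} → x ≗ y → applyNet f x ≗ applyNet f y
applyNet-cong []      x≗y = x≗y
applyNet-cong (c ∷ f) x≗y = applyNet-cong f (applyComp-cong c x≗y)

sum-applyNet : ∀ (f : Network n) x → sum (applyNet f x) ≡ sum x
sum-applyNet []      x = refl
sum-applyNet (c ∷ f) x = trans (sum-applyNet f (applyComp c x)) (sum-applyComp c x)

UnitGap : (Fin n → ℕ) → (Fin n → ℕ) → Set
UnitGap u v = Pointwise≤ u v × sum v ≡ suc (sum u)

unitGap-unique : ∀ {u v : Fin n → ℕ} → UnitGap u v →
  ∀ {t t′} → u t < v t → u t′ < v t′ → t ≡ t′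
unitGap-unique {u = u} (u≤v , Σv≡1+Σu) {t} {t′} ut<vt ut′<vt′ with t Fin.≟ t′
... | yes t≡t′ = t≡t′
... | no  t≢t′ =
  contradiction (subst (suc (sum u) <_) Σv≡1+Σu (sum-mono-<₂ u≤v t≢t′ ut<vt ut′<vt′)) (<-irrefl refl)

unitGap-cong : ∀ {u u′ v v′ : Fin n → ℕ} → u ≗ u′ → v ≗ v′ → UnitGap u v → UnitGap u′ v′
unitGap-cong u≗u′ v≗v′ (u≤v , Σv≡1+Σu) =
  (λ t → subst₂ _≤_ (u≗u′ t) (v≗v′ t) (u≤v t)) ,
  trans (sym (sum-cong-≗ v≗v′)) (trans Σv≡1+Σu (cong suc (sum-cong-≗ u≗u′)))

unitGap-applyComp : ∀ (c : Comparator n) {u v} → UnitGap u v → UnitGap (applyComp c u) (applyComp c v)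
unitGap-applyComp c {u} {v} (u≤v , Σv≡1+Σu) =
  applyComp-mono c u≤v ,
  trans (sum-applyComp c v) (trans Σv≡1+Σu (cong suc (sym (sum-applyComp c u))))

-- Top k sorted vectors

topSorted-antitone : ∀ {k} {x : Fin n → ℕ} → TopSorted k x →
  ∀ {a b} → toℕ a ≤ toℕ b → toℕ b < k → x b ≤ x a
topSorted-antitone {n} {k} {x} (adjacent , _) {a} {b} a≤b b<k =
  descend (toℕ b ∸ toℕ a) b (sym (m∸n+n≡m a≤b)) b<k
  where
  descend : ∀ d b → toℕ b ≡ d + toℕ a → toℕ b < k → x b ≤ x a
  descend zero    b b≡a     _   = ≤-reflexive (cong x (toℕ-injective b≡a))
  descend (suc d) b b≡1+d+a b<k =
    ≤-trans (adjacent b′ b 1+b′≡b b<k) (descend d b′ (toℕ-fromℕ< b′<n) b′<k)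
    where
    d+a<b : d + toℕ a < toℕ b
    d+a<b = subst (d + toℕ a <_) (sym b≡1+d+a) ≤-refl
    b′<n = <-trans d+a<b (toℕ<n b)
    b′ = fromℕ< b′<n
    1+b′≡b : suc (toℕ b′) ≡ toℕ b
    1+b′≡b = trans (cong suc (toℕ-fromℕ< b′<n)) (sym b≡1+d+a)
    b′<k : toℕ b′ < k
    b′<k = subst (_< k) (sym (toℕ-fromℕ< b′<n)) (<-trans d+a<b b<k)

topSorted-pivot-zero : ∀ {x : Fin n → ℕ} p → TopSorted (suc (toℕ p)) x → sum x ≡ toℕ p → x p ≡ 0
topSorted-pivot-zero {x = x} p sorted Σx≡p with x p in xp≡
... | zero  = refl
... | suc _ =
  contradiction (subst (suc (toℕ p) ≤_) Σx≡p (sum-≥-prefix x (suc (toℕ p)) (toℕ<n p) positive)) (<-irrefl refl)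
  where
  positive : ∀ a → toℕ a < suc (toℕ p) → 1 ≤ x a
  positive a (s≤s a≤p) =
    ≤-trans (subst (1 ≤_) (sym xp≡) (s≤s z≤n)) (topSorted-antitone sorted a≤p ≤-refl)

topSorted-pivot-one : ∀ {x : Fin n → ℕ} p → (∀ t → x t ≤ 1) → TopSorted (suc (toℕ p)) x →
  sum x ≡ suc (toℕ p) → x p ≡ 1
topSorted-pivot-one {x = x} p binary sorted Σx≡1+p with x p in xp≡
... | 1 = refl
... | suc (suc _) = contradiction (subst (_≤ 1) xp≡ (binary p)) λ { (s≤s ()) }
... | zero =
  contradiction (subst (_≤ toℕ p) Σx≡1+p (sum-≤-prefix x (toℕ p) (λ a _ → binary a) null)) (<-irrefl refl)
  where
  null : ∀ a → toℕ p ≤ toℕ a → x a ≡ 0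
  null a p≤a with toℕ p ℕ.≟ toℕ a
  ... | yes p≡a = trans (cong x (toℕ-injective (sym p≡a))) xp≡
  ... | no  p≢a = n≤0⇒n≡0 (subst (x a ≤_) xp≡ (proj₂ sorted p a ≤-refl (≤∧≢⇒< p≤a p≢a)))

-- Unit propagation against a model

evalLit : (Var → Bool) → Literal → Bool
evalLit ν (true  , v) = ν v
evalLit ν (false , v) = not (ν v)

_⊨_ : (Var → Bool) → CNF → Set
ν ⊨ φ = ∀ {C} → C ∈ φ → Any (λ l → evalLit ν l ≡ true) C

Agrees : (Var → Bool) → Assignment → Set
Agrees ν α = ∀ v {b} → α v ≡ just b → ν v ≡ b

_⊑_ : Assignment → Assignment → Set
α ⊑ β = ∀ v {b} → α v ≡ just b → β v ≡ just b

Fixpoint : CNF → Assignment → Set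
Fixpoint φ α = ∀ β → ¬ UPStep φ α β

-- does (v ℕ.≟ w) reduces to v ≡ᵇ w, the test used by set and evalComp.
set-≡ : ∀ α v b → set α v b v ≡ just b
set-≡ α v b = cong (if_then just b else α v) (dec-true (v ℕ.≟ v) refl)

set-≢ : ∀ α {v w} b → w ≢ v → set α v b w ≡ α w
set-≢ α {v} {w} b w≢v = cong (if_then just b else α w) (dec-false (w ℕ.≟ v) w≢v)

set-agrees : ∀ {ν α v b} → Agrees ν α → ν v ≡ b → Agrees ν (set α v b)
set-agrees {α = α} {v} {b} ν≈α νv≡b w αw≡b′ with w ℕ.≟ v
... | yes refl = trans νv≡b (just-injective (trans (sym (set-≡ α v b)) αw≡b′))
... | no  w≢v  = ν≈α w (trans (sym (set-≢ α b w≢v)) αw≡b′)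

set-⊑ : ∀ α v b → α v ≡ nothing → α ⊑ set α v b
set-⊑ α v b αv≡nothing w αw≡b′ with w ℕ.≟ v
... | yes refl = contradiction (trans (sym αw≡b′) αv≡nothing) λ ()
... | no  w≢v  = trans (set-≢ α b w≢v) αw≡b′

set-⊑-agrees : ∀ {ν α v b} → Agrees ν α → ν v ≡ b → α ⊑ set α v b
set-⊑-agrees {α = α} {v} {b} ν≈α νv≡b w αw≡b′ with w ℕ.≟ v
... | yes refl = trans (set-≡ α v b) (cong just (trans (sym νv≡b) (ν≈α v αw≡b′)))
... | no  w≢v  = trans (set-≢ α b w≢v) αw≡b′

evalLit-agrees : ∀ {ν α} → Agrees ν α → ∀ l {b} → litVal α l ≡ just b → evalLit ν l ≡ b
evalLit-agrees ν≈α (true  , v) αv≡b = ν≈α v αv≡b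
evalLit-agrees {α = α} ν≈α (false , v) ¬αv≡b with α v in αv≡
... | just b′ = trans (cong not (ν≈α v αv≡)) (just-injective ¬αv≡b)

evalLit-true : ∀ ν b v → evalLit ν (b , v) ≡ true → ν v ≡ b
evalLit-true ν true  v νv≡true = νv≡true
evalLit-true ν false v ¬νv≡true with ν v
... | false = refl

litVal-undefined : ∀ α b v → litVal α (b , v) ≡ nothing → α v ≡ nothing
litVal-undefined α true  v αv≡nothing = αv≡nothing
litVal-undefined α false v _ with α v
... | nothing = refl

module _ {ν φ α} (ν⊨φ : ν ⊨ φ) (ν≈α : Agrees ν α) where

  private
    notTrue : ∀ {l} → IsFalse α l → evalLit ν l ≢ true
    notTrue {l} l-false l-true = contradiction (trans (sym l-true) (evalLit-agrees ν≈α l l-false)) λ ()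

  unit-literal-true : ∀ L R l → (L ++ l ∷ R) ∈ φ → All (IsFalse α) L → All (IsFalse α) R →
    evalLit ν l ≡ true
  unit-literal-true L R l C∈φ falseL falseR with Any.++⁻ L (ν⊨φ C∈φ)
  ... | inj₁ trueL         = contradiction trueL (All¬⇒¬Any (All.map (λ {l} → notTrue {l}) falseL))
  ... | inj₂ (here l-true) = l-true
  ... | inj₂ (there trueR) = contradiction trueR (All¬⇒¬Any (All.map (λ {l} → notTrue {l}) falseR))

  upStep-agrees : ∀ {β} → UPStep φ α β → Agrees ν β
  upStep-agrees (unit L R (b , v) C∈φ falseL falseR _) =
    set-agrees ν≈α (evalLit-true ν b v (unit-literal-true L R (b , v) C∈φ falseL falseR))

  fixpoint-unit : Fixpoint φ α →
    ∀ L R l → (L ++ l ∷ R) ∈ φ → All (IsFalse α) L → All (IsFalse α) R → litVal α l ≡ just true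
  fixpoint-unit fix L R l C∈φ falseL falseR with litVal α l in αl≡
  ... | nothing = contradiction (unit L R l C∈φ falseL falseR αl≡) (fix _)
  ... | just b  =
    cong just (trans (sym (evalLit-agrees ν≈α l αl≡)) (unit-literal-true L R l C∈φ falseL falseR))

up*-agrees : ∀ {ν φ α β} → ν ⊨ φ → Star (UPStep φ) α β → Agrees ν α → Agrees ν β
up*-agrees ν⊨φ ε               ν≈α = ν≈α
up*-agrees ν⊨φ (step ◅ steps) ν≈α = up*-agrees ν⊨φ steps (upStep-agrees ν⊨φ ν≈α step)

up*-⊑ : ∀ {φ α β} → Star (UPStep φ) α β → α ⊑ β
up*-⊑ ε                                        v αv≡b = αv≡b
up*-⊑ (unit L R (b , v) _ _ _ undefined ◅ steps) w αw≡b′ =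
  up*-⊑ steps w (set-⊑ _ v b (litVal-undefined _ b v undefined) w αw≡b′)

litVal-neg : ∀ α v → litVal α (false , v) ≡ just true → α v ≡ just false
litVal-neg α v ¬αv≡true with α v
... | just false = refl

isFalse-neg : ∀ α {v} → α v ≡ just true → IsFalse α (false , v)
isFalse-neg α αv≡true rewrite αv≡true = refl

-- The valuation computed by the network

bit : Bool → ℕ
bit false = 0
bit true  = 1

bit-∨ : ∀ x y → bit (x ∨ y) ≡ bit x ⊔ bit y
bit-∨ false y    = refl
bit-∨ true false = refl
bit-∨ true true  = refl

bit-∧ : ∀ x y → bit (x ∧ y) ≡ bit x ⊓ bit y
bit-∧ false y     = refl
bit-∧ true  false = refl
bit-∧ true  true  = refl

bit≤1 : ∀ x → bit x ≤ 1
bit≤1 false = z≤n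
bit≤1 true  = s≤s z≤n

bit≡0 : ∀ {x} → bit x ≡ 0 → x ≡ false
bit≡0 {false} _ = refl

bit≡1 : ∀ {x} → bit x ≡ 1 → x ≡ true
bit≡1 {true} _ = refl

bit-mono : ∀ {x y} → bit x ≤ bit y → x ≡ true → y ≡ true
bit-mono {y = true}  _ _ = refl
bit-mono {y = false} () refl

open EncState

CurBelowFresh : EncState n → Set
CurBelowFresh s = ∀ t → cur s t < fresh s

curBelowFresh-encComp : ∀ (c : Comparator n) s → CurBelowFresh s → CurBelowFresh (encComp c s)
curBelowFresh-encComp (comp i j _) s below t with does (t Fin.≟ i) | does (t Fin.≟ j)
... | true  | _     = m<n⇒m<1+n (n<1+n (fresh s))
... | false | true  = n<1+n (suc (fresh s))
... | false | false = m<n⇒m<1+n (m<n⇒m<1+n (below t))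

evalComp : EncState n → Comparator n → (Var → Bool) → Var → Bool
evalComp s (comp i j _) ν v =
  if v ≡ᵇ fresh s then ν (cur s i) ∨ ν (cur s j)
  else if v ≡ᵇ suc (fresh s) then ν (cur s i) ∧ ν (cur s j)
  else ν v

evalNet : Network n → EncState n → (Var → Bool) → Var → Bool
evalNet []       s ν = ν
evalNet (c ∷ cs) s ν = evalNet cs (encComp c s) (evalComp s c ν)

evalComp-below : ∀ s (c : Comparator n) ν {v} → v < fresh s → evalComp s c ν v ≡ ν v
evalComp-below s (comp i j _) ν {v} v<fresh
  rewrite dec-false (v ℕ.≟ fresh s) (<⇒≢ v<fresh)
        | dec-false (v ℕ.≟ suc (fresh s)) (<⇒≢ (m<n⇒m<1+n v<fresh)) = refl

evalNet-below : ∀ (cs : Network n) s ν {v} → v < fresh s → evalNet cs s ν v ≡ ν v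
evalNet-below []            s ν v<fresh = refl
evalNet-below (c@(comp _ _ _) ∷ cs) s ν v<fresh =
  trans (evalNet-below cs (encComp c s) _ (m<n⇒m<1+n (m<n⇒m<1+n v<fresh))) (evalComp-below s c ν v<fresh)

module _ {n} (i j : Fin n) (i<j : i Fin.< j) (cs : Network n) (s : EncState n) (ν : Var → Bool)
         (below : CurBelowFresh s) where

  private
    N = evalNet (comp i j i<j ∷ cs) s ν
    fresh+1>fresh = n<1+n (fresh s)

    N-cur : ∀ t → N (cur s t) ≡ ν (cur s t)
    N-cur t = evalNet-below (comp i j i<j ∷ cs) s ν (below t)

  evalNet-max : N (fresh s) ≡ N (cur s i) ∨ N (cur s j)
  evalNet-max rewrite N-cur i | N-cur j
    | evalNet-below cs (encComp (comp i j i<j) s) (evalComp s (comp i j i<j) ν) (m<n⇒m<1+n fresh+1>fresh)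
    | dec-true (fresh s ℕ.≟ fresh s) refl = refl

  evalNet-min : N (suc (fresh s)) ≡ N (cur s i) ∧ N (cur s j)
  evalNet-min rewrite N-cur i | N-cur j
    | evalNet-below cs (encComp (comp i j i<j) s) (evalComp s (comp i j i<j) ν) (n<1+n (suc (fresh s)))
    | dec-false (suc (fresh s) ℕ.≟ fresh s) (≢-sym (<⇒≢ fresh+1>fresh))
    | dec-true (suc (fresh s) ℕ.≟ suc (fresh s)) refl = refl

hcomp-⊨ : ∀ ν {a b c d} → ν c ≡ ν a ∨ ν b → ν d ≡ ν a ∧ ν b → ν ⊨ hcomp a b c d
hcomp-⊨ ν {a} {b} c≡a∨b d≡a∧b (here refl) with ν a in νa
... | false = here (cong not νa)
... | true  = there (here c≡a∨b)
hcomp-⊨ ν {a} {b} c≡a∨b d≡a∧b (there (here refl)) with ν b in νb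
... | false = here (cong not νb)
... | true  = there (here (trans c≡a∨b (∨-zeroʳ (ν a))))
hcomp-⊨ ν {a} {b} c≡a∨b d≡a∧b (there (there (here refl))) with ν a in νa | ν b in νb
... | false | _     = here (cong not νa)
... | true  | false = there (here (cong not νb))
... | true  | true  = there (there (here d≡a∧b))

∈-encNet : ∀ (cs : Network n) s {C} → C ∈ clauses s → C ∈ clauses (encNet cs s)
∈-encNet []       s C∈s = C∈s
∈-encNet (c ∷ cs) s C∈s = ∈-encNet cs (encComp c s) (∈-++⁺ˡ C∈s)

hcomp-∈ : ∀ i j (i<j : i Fin.< j) (cs : Network n) s {C} →
  C ∈ hcomp (cur s i) (cur s j) (fresh s) (suc (fresh s)) → C ∈ clauses (encNet (comp i j i<j ∷ cs) s)
hcomp-∈ i j i<j cs s C∈hcomp = ∈-encNet cs (encComp (comp i j i<j) s) (∈-++⁺ʳ (clauses s) C∈hcomp)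

evalNet-⊨ : ∀ (cs : Network n) s ν → CurBelowFresh s →
  evalNet cs s ν ⊨ clauses s → evalNet cs s ν ⊨ clauses (encNet cs s)
evalNet-⊨ []                     s ν below ⊨s = ⊨s
evalNet-⊨ (c@(comp i j i<j) ∷ cs) s ν below ⊨s =
  evalNet-⊨ cs (encComp c s) (evalComp s c ν) (curBelowFresh-encComp c s below) ⊨s′
  where
  ⊨s′ : evalNet (c ∷ cs) s ν ⊨ clauses (encComp c s)
  ⊨s′ C∈s′ with ∈-++⁻ (clauses s) C∈s′
  ... | inj₁ C∈s      = ⊨s C∈s
  ... | inj₂ C∈hcomp =
    hcomp-⊨ _ (evalNet-max i j i<j cs s ν below) (evalNet-min i j i<j cs s ν below) C∈hcomp

wires : (Var → Bool) → EncState n → Fin n → ℕ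
wires N s t = bit (N (cur s t))

wires-encComp : ∀ (c : Comparator n) cs s ν → CurBelowFresh s →
  let N = evalNet (c ∷ cs) s ν in wires N (encComp c s) ≗ applyComp c (wires N s)
wires-encComp (comp i j i<j) cs s ν below t with does (t Fin.≟ i) | does (t Fin.≟ j)
... | true  | _     = trans (cong bit (evalNet-max i j i<j cs s ν below)) (bit-∨ (N (cur s i)) (N (cur s j)))
  where N = evalNet (comp i j i<j ∷ cs) s ν
... | false | true  = trans (cong bit (evalNet-min i j i<j cs s ν below)) (bit-∧ (N (cur s i)) (N (cur s j)))
  where N = evalNet (comp i j i<j ∷ cs) s ν
... | false | false = refl

wires-encNet : ∀ (cs : Network n) s ν → CurBelowFresh s →
  let N = evalNet cs s ν in wires N (encNet cs s) ≗ applyNet cs (wires N s)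
wires-encNet []       s ν below t = refl
wires-encNet (c ∷ cs) s ν below t =
  trans (wires-encNet cs (encComp c s) (evalComp s c ν) (curBelowFresh-encComp c s below) t)
        (applyNet-cong cs (wires-encComp c cs s ν below) t)

unitGap-encComp : ∀ (c : Comparator n) cs s ν ν′ → CurBelowFresh s →
  let N = evalNet (c ∷ cs) s ν; N′ = evalNet (c ∷ cs) s ν′ in
  UnitGap (wires N s) (wires N′ s) → UnitGap (wires N (encComp c s)) (wires N′ (encComp c s))
unitGap-encComp c cs s ν ν′ below gap =
  unitGap-cong (sym ∘ wires-encComp c cs s ν below) (sym ∘ wires-encComp c cs s ν′ below)
    (unitGap-applyComp c gap)

unitGap-encNet : ∀ (cs : Network n) s ν ν′ → CurBelowFresh s →
  let N = evalNet cs s ν; N′ = evalNet cs s ν′ in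
  UnitGap (wires N s) (wires N′ s) → UnitGap (wires N (encNet cs s)) (wires N′ (encNet cs s))
unitGap-encNet []       s ν ν′ below gap = gap
unitGap-encNet (c ∷ cs) s ν ν′ below gap =
  unitGap-encNet cs (encComp c s) (evalComp s c ν) (evalComp s c ν′) (curBelowFresh-encComp c s below)
    (unitGap-encComp c cs s ν ν′ below gap)

-- Propagation through the encoding

module _ {n} {i j : Fin n} (i<j : i Fin.< j) (s : EncState n) where

  cur-encComp-i : cur (encComp (comp i j i<j) s) i ≡ fresh s
  cur-encComp-i rewrite dec-true (i Fin.≟ i) refl = refl

  cur-encComp-j : cur (encComp (comp i j i<j) s) j ≡ suc (fresh s)
  cur-encComp-j rewrite dec-false (j Fin.≟ i) (≢-sym (<⇒≢ᶠ i<j)) | dec-true (j Fin.≟ j) refl = refl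

  cur-encComp-other : ∀ {t} → t ≢ i → t ≢ j → cur (encComp (comp i j i<j) s) t ≡ cur s t
  cur-encComp-other {t} t≢i t≢j rewrite dec-false (t Fin.≟ i) t≢i | dec-false (t Fin.≟ j) t≢j = refl

Complete : (Var → Bool) → Assignment → EncState n → Set
Complete N α s = ∀ t → N (cur s t) ≡ true → α (cur s t) ≡ just true

complete-⊑ : ∀ {N α β} {s : EncState n} → α ⊑ β → Complete N α s → Complete N β s
complete-⊑ {s = s} α⊑β complete t Nt≡true = α⊑β (cur s t) (complete t Nt≡true)

Differs : (Var → Bool) → (Var → Bool) → Var → Set
Differs N N′ v = N v ≡ false × N′ v ≡ true

FalseOnDiffering : (Var → Bool) → (Var → Bool) → Assignment → EncState n → Set
FalseOnDiffering N N′ α s = ∀ t → Differs N N′ (cur s t) → α (cur s t) ≡ just false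

differs-< : ∀ N N′ {v} → Differs N N′ v → bit (N v) < bit (N′ v)
differs-< N N′ (Nv≡false , N′v≡true) rewrite Nv≡false | N′v≡true = s≤s z≤n

falseOnDiffering-unique : ∀ {N N′ α} {s : EncState n} → UnitGap (wires N s) (wires N′ s) →
  ∀ p → Differs N N′ (cur s p) → α (cur s p) ≡ just false → FalseOnDiffering N N′ α s
falseOnDiffering-unique {N = N} {N′} {α} {s} gap p p-differs αp≡false t t-differs =
  subst (λ q → α (cur s q) ≡ just false)
    (unitGap-unique gap (differs-< N N′ p-differs) (differs-< N N′ t-differs)) αp≡false

module _ {n} (i j : Fin n) (i<j : i Fin.< j) (cs : Network n) (s : EncState n) (ν : Var → Bool)
         (below : CurBelowFresh s) {α : Assignment}
         (N⊨φ : evalNet (comp i j i<j ∷ cs) s ν ⊨ clauses (encNet (comp i j i<j ∷ cs) s))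
         (N≈α : Agrees (evalNet (comp i j i<j ∷ cs) s ν) α)
         (fix : Fixpoint (clauses (encNet (comp i j i<j ∷ cs) s)) α) where

  private
    c = comp i j i<j
    N = evalNet (c ∷ cs) s ν
    s′ = encComp c s
    a = cur s i
    b = cur s j

    forced : ∀ L R l → (L ++ l ∷ R) ∈ hcomp a b (fresh s) (suc (fresh s)) →
      All (IsFalse α) L → All (IsFalse α) R → litVal α l ≡ just true
    forced L R l C∈hcomp = fixpoint-unit N⊨φ N≈α fix L R l (hcomp-∈ i j i<j cs s C∈hcomp)

  complete-encComp : Complete N α s → Complete N α s′
  complete-encComp complete t with does (t Fin.≟ i) | does (t Fin.≟ j)
  ... | false | false = complete t
  ... | true  | _     = λ Nc≡true → maxTrue (trans (sym (evalNet-max i j i<j cs s ν below)) Nc≡true)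
    where
    maxTrue : N a ∨ N b ≡ true → α (fresh s) ≡ just true
    maxTrue a∨b≡true with N a in Na
    ... | true  = forced (_ ∷ []) [] _ (here refl) (isFalse-neg α (complete i Na) ∷ []) []
    ... | false = forced (_ ∷ []) [] _ (there (here refl)) (isFalse-neg α (complete j a∨b≡true) ∷ []) []
  ... | false | true  = λ Nd≡true → minTrue (trans (sym (evalNet-min i j i<j cs s ν below)) Nd≡true)
    where
    minTrue : N a ∧ N b ≡ true → α (suc (fresh s)) ≡ just true
    minTrue a∧b≡true with N a in Na | N b in Nb
    ... | true | true = forced (_ ∷ _ ∷ []) [] _ (there (there (here refl)))
                          (isFalse-neg α (complete i Na) ∷ isFalse-neg α (complete j Nb) ∷ []) []

  module _ (ν′ : Var → Bool) (complete : Complete N α s)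
           (gap : UnitGap (wires N s) (wires (evalNet (c ∷ cs) s ν′) s))
           (false′ : FalseOnDiffering N (evalNet (c ∷ cs) s ν′) α s′) where

    private
      N′ = evalNet (c ∷ cs) s ν′

      maxFalse : N a ∨ N b ≡ false → N′ a ∨ N′ b ≡ true → α (fresh s) ≡ just false
      maxFalse a∨b≡false a∨b≡true′ =
        subst (λ v → α v ≡ just false) (cur-encComp-i i<j s)
          (false′ i (subst (Differs N N′) (sym (cur-encComp-i i<j s))
            (trans (evalNet-max i j i<j cs s ν below) a∨b≡false ,
             trans (evalNet-max i j i<j cs s ν′ below) a∨b≡true′)))

      minFalse : N a ∧ N b ≡ false → N′ a ∧ N′ b ≡ true → α (suc (fresh s)) ≡ just false
      minFalse a∧b≡false a∧b≡true′ =
        subst (λ v → α v ≡ just false) (cur-encComp-j i<j s)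
          (false′ j (subst (Differs N N′) (sym (cur-encComp-j i<j s))
            (trans (evalNet-min i j i<j cs s ν below) a∧b≡false ,
             trans (evalNet-min i j i<j cs s ν′ below) a∧b≡true′)))

      notBoth : Differs N N′ a → Differs N N′ b → ⊥
      notBoth a-differs b-differs =
        <⇒≢ᶠ i<j (unitGap-unique gap (differs-< N N′ a-differs) (differs-< N N′ b-differs))

      true′ : ∀ t → N (cur s t) ≡ true → N′ (cur s t) ≡ true
      true′ t = bit-mono (proj₁ gap t)

      -- Below the comparator the differing wire is c if b is false and d if b is true.
      upperFalse : Differs N N′ a → α a ≡ just false
      upperFalse (Na , N′a) with N b in Nb
      ... | true  = litVal-neg α a (forced [] (_ ∷ _ ∷ []) _ (there (there (here refl))) []
                      (isFalse-neg α (complete j Nb) ∷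
                       minFalse (cong₂ _∧_ Na Nb) (cong₂ _∧_ N′a (true′ j Nb)) ∷ []))
      ... | false with N′ b in N′b
      ...   | true  = contradiction (Nb , N′b) (notBoth (Na , N′a))
      ...   | false = litVal-neg α a (forced [] (_ ∷ []) _ (here refl) []
                      (maxFalse (cong₂ _∨_ Na Nb) (cong₂ _∨_ N′a N′b) ∷ []))

      lowerFalse : Differs N N′ b → α b ≡ just false
      lowerFalse (Nb , N′b) with N a in Na
      ... | true  = litVal-neg α b (forced (_ ∷ []) (_ ∷ []) _ (there (there (here refl)))
                      (isFalse-neg α (complete i Na) ∷ [])
                      (minFalse (cong₂ _∧_ Na Nb) (cong₂ _∧_ (true′ i Na) N′b) ∷ []))
      ... | false with N′ a in N′a
      ...   | true  = contradiction (Nb , N′b) (notBoth (Na , N′a))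
      ...   | false = litVal-neg α b (forced [] (_ ∷ []) _ (there (here refl)) []
                      (maxFalse (cong₂ _∨_ Na Nb) (cong₂ _∨_ N′a N′b) ∷ []))

    falseOnDiffering-encComp : FalseOnDiffering N N′ α s
    falseOnDiffering-encComp t t-differs with t Fin.≟ i | t Fin.≟ j
    ... | yes refl | _        = upperFalse t-differs
    ... | no _     | yes refl = lowerFalse t-differs
    ... | no t≢i   | no t≢j   =
      subst (λ v → α v ≡ just false) (cur-encComp-other i<j s t≢i t≢j)
        (false′ t (subst (Differs N N′) (sym (cur-encComp-other i<j s t≢i t≢j)) t-differs))

falseOnDiffering-encNet : ∀ (cs : Network n) s ν ν′ {α} → CurBelowFresh s →
  let N = evalNet cs s ν; N′ = evalNet cs s ν′; φ = clauses (encNet cs s) in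
  N ⊨ φ → Agrees N α → Fixpoint φ α → Complete N α s → UnitGap (wires N s) (wires N′ s) →
  FalseOnDiffering N N′ α (encNet cs s) → FalseOnDiffering N N′ α s
falseOnDiffering-encNet []                      s ν ν′ below N⊨φ N≈α fix complete gap onOutputs = onOutputs
falseOnDiffering-encNet (c@(comp i j i<j) ∷ cs) s ν ν′ below N⊨φ N≈α fix complete gap onOutputs =
  falseOnDiffering-encComp i j i<j cs s ν below N⊨φ N≈α fix ν′ complete gap
    (falseOnDiffering-encNet cs (encComp c s) (evalComp s c ν) (evalComp s c ν′) (curBelowFresh-encComp c s below)
      N⊨φ N≈α fix (complete-encComp i j i<j cs s ν below N⊨φ N≈α fix complete)
      (unitGap-encComp c cs s ν ν′ below gap) onOutputs)

inputs : Subset n → Var → Bool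
inputs T v = fromMaybe false (initAssign T v)

initAssign-below : ∀ (T : Subset n) v {b} → initAssign T v ≡ just b → v < n
initAssign-below {n} T v initv≡b with v <? n
... | yes v<n = v<n

initAssign-toℕ : ∀ (T : Subset n) t → initAssign T (toℕ t) ≡ (if lookup T t then just true else nothing)
initAssign-toℕ {n} T t with toℕ t <? n
... | yes t<n rewrite fromℕ<-toℕ t t<n = refl
... | no  t≮n = contradiction (toℕ<n t) t≮n

inputs-toℕ : ∀ (T : Subset n) t → inputs T (toℕ t) ≡ lookup T t
inputs-toℕ T t rewrite initAssign-toℕ T t with lookup T t
... | true  = refl
... | false = refl

sum-bit-lookup : ∀ (T : Subset n) → sum (bit ∘ lookup T) ≡ ∣ T ∣
sum-bit-lookup []          = refl
sum-bit-lookup (true  ∷ T) = cong suc (sum-bit-lookup T)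
sum-bit-lookup (false ∷ T) = sum-bit-lookup T

∉⇒lookup≡false : ∀ {T : Subset n} {i} → i ∉ T → lookup T i ≡ false
∉⇒lookup≡false {T = T} {i} i∉T with lookup T i in Ti
... | true  = contradiction (lookup⇒[]= i T Ti) i∉T
... | false = refl

unitGap-insert : ∀ (T : Subset n) i → lookup T i ≡ false →
  UnitGap (bit ∘ lookup T) (bit ∘ lookup (T [ i ]≔ true))
unitGap-insert T i Ti≡false =
  below , sum-increment i (trans (cong bit (lookup∘updateAt i T)) (cong (suc ∘ bit) (sym Ti≡false))) same
  where
  same : ∀ t → t ≢ i → bit (lookup (T [ i ]≔ true) t) ≡ bit (lookup T t)
  same t t≢i = cong bit (lookup∘updateAt′ t i t≢i T)
  below : Pointwise≤ (bit ∘ lookup T) (bit ∘ lookup (T [ i ]≔ true))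
  below t with t Fin.≟ i
  ... | yes refl = subst (_≤ bit (lookup (T [ i ]≔ true) i)) (cong bit (sym Ti≡false)) z≤n
  ... | no  t≢i  = ≤-reflexive (sym (same t t≢i))

∣insert∣ : ∀ (T : Subset n) i → lookup T i ≡ false → ∣ T [ i ]≔ true ∣ ≡ suc ∣ T ∣
∣insert∣ T i Ti≡false = begin
  ∣ T [ i ]≔ true ∣                 ≡⟨ sum-bit-lookup (T [ i ]≔ true) ⟨
  sum (bit ∘ lookup (T [ i ]≔ true)) ≡⟨ proj₂ (unitGap-insert T i Ti≡false) ⟩
  suc (sum (bit ∘ lookup T))         ≡⟨ cong suc (sum-bit-lookup T) ⟩
  suc ∣ T ∣                         ∎
  where open ≡-Reasoning

module _ {n} (f : Network n) where

  private
    s₀ = initState n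

  curBelowFresh-init : CurBelowFresh s₀
  curBelowFresh-init = toℕ<n

  evalNet-⊨-phi : ∀ ν → evalNet f s₀ ν ⊨ phi f
  evalNet-⊨-phi ν = evalNet-⊨ f s₀ ν curBelowFresh-init λ ()

  module _ (T : Subset n) where

    private
      N = evalNet f s₀ (inputs T)

    evalNet-input : ∀ t → N (toℕ t) ≡ lookup T t
    evalNet-input t = trans (evalNet-below f s₀ (inputs T) (toℕ<n t)) (inputs-toℕ T t)

    wires-init : wires N s₀ ≗ bit ∘ lookup T
    wires-init t = cong bit (evalNet-input t)

    output-applyNet : ∀ t → bit (N (outVar f t)) ≡ applyNet f (bit ∘ lookup T) t
    output-applyNet t = trans (wires-encNet f s₀ (inputs T) curBelowFresh-init t) (applyNet-cong f wires-init t)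

    initAssign-agrees : Agrees N (initAssign T)
    initAssign-agrees v initv≡b =
      trans (evalNet-below f s₀ (inputs T) (initAssign-below T v initv≡b)) (cong (fromMaybe false) initv≡b)

    initAssign-complete : Complete N (initAssign T) s₀
    initAssign-complete t Nt≡true rewrite initAssign-toℕ T t | sym (evalNet-input t) | Nt≡true = refl

    selection-output-false : ∀ p → SelectionNetwork (suc (toℕ p)) f →
      ∣ T ∣ ≡ toℕ p → N (outVar f p) ≡ false
    selection-output-false p selection ∣T∣≡p = bit≡0 (trans (output-applyNet p)
      (topSorted-pivot-zero p (selection _) (trans (sum-applyNet f _) (trans (sum-bit-lookup T) ∣T∣≡p))))

    selection-output-true : ∀ p → SelectionNetwork (suc (toℕ p)) f →
      ∣ T ∣ ≡ suc (toℕ p) → N (outVar f p) ≡ true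
    selection-output-true p selection ∣T∣≡1+p = bit≡1 (trans (output-applyNet p)
      (topSorted-pivot-one p binary (selection _) (trans (sum-applyNet f _) (trans (sum-bit-lookup T) ∣T∣≡1+p))))
      where
      binary : ∀ t → applyNet f (bit ∘ lookup T) t ≤ 1
      binary t = subst (_≤ 1) (output-applyNet t) (bit≤1 _)

    propagation-agrees-complete : ∀ {α₁ α₂} y →
      Star (UPStep (phi f)) (initAssign T) α₁ → N y ≡ false → Star (UPStep (phi f)) (set α₁ y false) α₂ →
      Agrees N α₂ × Complete N α₂ s₀
    propagation-agrees-complete y up₁ Ny≡false up₂ =
      up*-agrees (evalNet-⊨-phi _) up₂ (set-agrees agrees₁ Ny≡false) ,
      complete-⊑ {N = N} {s = s₀} (λ v → up*-⊑ up₂ v ∘ set-⊑-agrees agrees₁ Ny≡false v ∘ up*-⊑ up₁ v)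
        initAssign-complete
      where
      agrees₁ = up*-agrees (evalNet-⊨-phi _) up₁ initAssign-agrees

  unitGap-init : ∀ T i → lookup T i ≡ false →
    UnitGap (wires (evalNet f s₀ (inputs T)) s₀) (wires (evalNet f s₀ (inputs (T [ i ]≔ true))) s₀)
  unitGap-init T i Ti≡false =
    unitGap-cong (sym ∘ wires-init T) (sym ∘ wires-init (T [ i ]≔ true)) (unitGap-insert T i Ti≡false)

theorem6 : ∀ (n k : ℕ) (f : Network n) → 1 ≤ k → k ≤ n →
    SelectionNetwork k f →
    ∀ (T : Subset n) → ∣ T ∣ ≡ k ∸ 1 →
    ∀ (α₁ : Assignment) → UnitPropagates (phi f) (initAssign T) α₁ →
    ∀ (pk : Fin n) → suc (toℕ pk) ≡ k →
    ∀ (α₂ : Assignment) → UnitPropagates (phi f) (set α₁ (outVar f pk) false) α₂ →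
    ∀ (i : Fin n) → i ∉ T → α₂ (inVar i) ≡ just false
-- The bounds on k follow from k = suc (toℕ pk), and α₁ need not be a fixpoint.
theorem6 n _ f _ _ selection T ∣T∣≡k-1 α₁ (up₁ , _) pk refl α₂ (up₂ , fix₂) i i∉T =
  falseOnDiffering-encNet f s₀ (inputs T) (inputs T′) (curBelowFresh-init f) (evalNet-⊨-phi f _)
    (proj₁ propagated) fix₂ (proj₂ propagated) gap onOutputs
    i (trans (evalNet-input f T i) Ti≡false , trans (evalNet-input f T′ i) (lookup∘updateAt i T))
  where
  s₀ = initState n
  T′ = T [ i ]≔ true
  N = evalNet f s₀ (inputs T)
  N′ = evalNet f s₀ (inputs T′)
  y = outVar f pk

  Ti≡false : lookup T i ≡ false
  Ti≡false = ∉⇒lookup≡false i∉T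

  gap : UnitGap (wires N s₀) (wires N′ s₀)
  gap = unitGap-init f T i Ti≡false

  y≡false : N y ≡ false
  y≡false = selection-output-false f T pk selection ∣T∣≡k-1

  y≡true′ : N′ y ≡ true
  y≡true′ = selection-output-true f T′ pk selection (trans (∣insert∣ T i Ti≡false) (cong suc ∣T∣≡k-1))

  propagated : Agrees N α₂ × Complete N α₂ s₀
  propagated = propagation-agrees-complete f T y up₁ y≡false up₂

  onOutputs : FalseOnDiffering N N′ α₂ (encNet f s₀)
  onOutputs = falseOnDiffering-unique {N = N} {N′} {α₂} {encNet f s₀}
    (unitGap-encNet f s₀ (inputs T) (inputs T′) (curBelowFresh-init f) gap)
    pk (y≡false , y≡true′) (up*-⊑ up₂ y (set-≡ α₁ y false))
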